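{- The canonical model ${\mathcal M}_c=(|{\mathcal M}_c|,\preccurlyeq_c,S_c,\ell_c)$ is a deterministic weak $\mathcal L_\lozenge$-quasimodel.
   Context: $\mathcal L_\lozenge$ is the language $\bot\mid p\mid\varphi\wedge\psi\mid\varphi\vee\psi\mid\varphi\to\psi\mid\bigcirc\varphi\mid\lozenge\varphi$. ${\sf ITL}^0_\lozenge$ is the least set of $\mathcal L_\lozenge$-formulas containing all intuitionistic propositional tautologies and all instances of $\neg\bigcirc\bot$; $\bigcirc\varphi\wedge\bigcirc\psi\to\bigcirc(\varphi\wedge\psi)$; $\bigcirc(\varphi\vee\psi)\to\bigcirc\varphi\vee\bigcirc\psi$; $\bigcirc(\varphi\to\psi)\to(\bigcirc\varphi\to\bigcirc\psi)$; $\varphi\vee\bigcirc\lozenge\varphi\to\lozenge\varphi$; closed under modus ponens, from $\varphi$ infer $\bigcirc\varphi$, from $\varphi\to\psi$ infer $\lozenge\varphi\to\lozenge\psi$, from $\bigcirc\varphi\to\varphi$ infer $\lozenge\varphi\to\varphi$. $\Gamma\vdash\Delta$ means $\bigwedge\Gamma'\to\bigvee\Delta'\in{\sf ITL}^0_\lozenge$ for some finite $\Gamma'\subseteq\Gamma,\Delta'\subseteq\Delta$. A prime type is a pair $\Phi=(\Phi^-,\Phi^+)$ with $\Phi^-\cup\Phi^+=\mathcal L_\lozenge$ and $\Phi^+\not\vdash\Phi^-$. The canonical model has as points all prime types, $\Phi\preccurlyeq_c\Psi$ iff $\Phi^+\subseteq\Psi^+$, $\Phi\,S_c\,\Psi$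 iff $\Phi\,S_T\,\Psi$, and $\ell_c(\Phi)=\Phi$. Here, for pairs $\Phi,\Psi$, $\Phi\,S_T\,\Psi$ iff for all $\varphi$: $\bigcirc\varphi\in\Phi^+\Rightarrow\varphi\in\Psi^+$; $\bigcirc\varphi\in\Phi^-\Rightarrow\varphi\in\Psi^-$; ($\lozenge\varphi\in\Phi^+$ and $\varphi\in\Phi^-$) $\Rightarrow\lozenge\varphi\in\Psi^+$; $\lozenge\varphi\in\Phi^-\Rightarrow\lozenge\varphi\in\Psi^-$. For $\Sigma$ closed under subformulas, a $\Sigma$-type is a pair $(\Phi^-;\Phi^+)$ of subsets of $\Sigma$ with $\Phi^-\cap\Phi^+=\varnothing$, $\Phi^-\cup\Phi^+=\Sigma$, $\bot\notin\Phi^+$; $\varphi\wedge\psi\in\Phi^+$ iff $\varphi,\psi\in\Phi^+$ (for $\varphi\wedge\psi\in\Sigma$); $\varphi\vee\psi\in\Phi^+$ iff $\varphi\in\Phi^+$ or $\psi\in\Phi^+$ (for $\varphi\vee\psi\in\Sigma$); $\varphi\to\psi\in\Phi^+$ implies $\varphi\in\Phi^-$ or $\psi\in\Phi^+$; $\lozenge\varphi\in\Phi^-$ implies $\varphi\in\Phi^-$. A $\Sigma$-labelled frame is $(W,\preccurlyeq,\ell)$ with $\preccurlyeq$ a partial order and $\ell$ mapping into $\Sigma$-types such that $w\preccurlyeq v$ implies $\ell^+(w)\subseteq\ell^+(v)$ and whenever $\varphi\to\psi\in\ell^-(w)$ there is $v\succcurlyeq w$ with $\varphi\in\ell^+(v)$,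 $\psi\in\ell^-(v)$. A weak $\Sigma$-quasimodel is $(W,\preccurlyeq,S,\ell)$ with $(W,\preccurlyeq,\ell)$ a $\Sigma$-labelled frame and $S\subseteq W\times W$ forward-confluent (if $w\preccurlyeq w'$ and $w\,S\,v$ then $w'\,S\,v'$ for some $v'\succcurlyeq v$) and sensible ($w\,S\,v$ implies $\ell(w)\,S_T\,\ell(v)$); it is deterministic if $S$ is a (total) function. -}

module Defs where

open import Level using (Level; _⊔_; suc; 0ℓ)
open import Data.Nat using (ℕ)
open import Data.List using (List; []; _∷_)
open import Data.List.Relation.Unary.All using (All)
open import Data.Product using (_×_; Σ; ∃; ∃-syntax; _,_)
open import Data.Sum using (_⊎_)
open import Relation.Nullary using (¬_)
open import Relation.Unary using (Pred; _⊆_; _∈_; _∉_; U)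
open import Relation.Binary.Core using (Rel)
open import Relation.Binary.Structures using (IsPartialOrder)

infixr 4 _⇒_
infixr 5 _∨_
infixr 6 _∧_

data Fm : Set where
  ⊥'  : Fm
  var : ℕ → Fm
  _∧_ : Fm → Fm → Fm
  _∨_ : Fm → Fm → Fm
  _⇒_ : Fm → Fm → Fm
  ○   : Fm → Fm
  ◇   : Fm → Fm

¬' : Fm → Fm
¬' φ = φ ⇒ ⊥'

⊤' : Fm
⊤' = ⊥' ⇒ ⊥'

-- The logic ITL⁰◇ as an inductive set of theorems.
-- "All intuitionistic propositional tautologies" (over L◇-formulas) is
-- realised by the standard Hilbert axiom schemes of IPC; together with
-- modus ponens these generate exactly the substitution instances of IPC
-- tautologies.

data ITL : Fm → Set where
  ax-K    : ∀ {φ ψ} → ITL (φ ⇒ ψ ⇒ φ)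
  ax-S    : ∀ {φ ψ χ} → ITL ((φ ⇒ ψ ⇒ χ) ⇒ (φ ⇒ ψ) ⇒ φ ⇒ χ)
  ax-∧E₁  : ∀ {φ ψ} → ITL (φ ∧ ψ ⇒ φ)
  ax-∧E₂  : ∀ {φ ψ} → ITL (φ ∧ ψ ⇒ ψ)
  ax-∧I   : ∀ {φ ψ} → ITL (φ ⇒ ψ ⇒ φ ∧ ψ)
  ax-∨I₁  : ∀ {φ ψ} → ITL (φ ⇒ φ ∨ ψ)
  ax-∨I₂  : ∀ {φ ψ} → ITL (ψ ⇒ φ ∨ ψ)
  ax-∨E   : ∀ {φ ψ χ} → ITL ((φ ⇒ χ) ⇒ (ψ ⇒ χ) ⇒ φ ∨ ψ ⇒ χ)
  ax-⊥E   : ∀ {φ} → ITL (⊥' ⇒ φ)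
  ax-○⊥   : ITL (¬' (○ ⊥'))
  ax-○∧   : ∀ {φ ψ} → ITL (○ φ ∧ ○ ψ ⇒ ○ (φ ∧ ψ))
  ax-○∨   : ∀ {φ ψ} → ITL (○ (φ ∨ ψ) ⇒ ○ φ ∨ ○ ψ)
  ax-○⇒   : ∀ {φ ψ} → ITL (○ (φ ⇒ ψ) ⇒ ○ φ ⇒ ○ ψ)
  ax-◇fix : ∀ {φ} → ITL (φ ∨ ○ (◇ φ) ⇒ ◇ φ)
  mp      : ∀ {φ ψ} → ITL (φ ⇒ ψ) → ITL φ → ITL ψ
  nec     : ∀ {φ} → ITL φ → ITL (○ φ)
  ◇mono   : ∀ {φ ψ} → ITL (φ ⇒ ψ) → ITL (◇ φ ⇒ ◇ ψ)
  ◇ind    : ∀ {φ} → ITL (○ φ ⇒ φ) → ITL (◇ φ ⇒ φ)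

⋀ : List Fm → Fm
⋀ []       = ⊤'
⋀ (φ ∷ Γ)  = φ ∧ ⋀ Γ

⋁ : List Fm → Fm
⋁ []       = ⊥'
⋁ (φ ∷ Δ)  = φ ∨ ⋁ Δ

_⊢_ : Pred Fm 0ℓ → Pred Fm 0ℓ → Set
Γ ⊢ Δ = ∃[ Γ' ] ∃[ Δ' ] (All Γ Γ' × All Δ Δ' × ITL (⋀ Γ' ⇒ ⋁ Δ'))

record Pair : Set₁ where
  constructor ⟨_,_⟩
  field
    neg : Pred Fm 0ℓ
    pos : Pred Fm 0ℓ
open Pair public

record ST (Φ Ψ : Pair) : Set where
  field
    ○pos : ∀ φ → ○ φ ∈ pos Φ → φ ∈ pos Ψ
    ○neg : ∀ φ → ○ φ ∈ neg Φ → φ ∈ neg Ψ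
    ◇pos : ∀ φ → ◇ φ ∈ pos Φ → φ ∈ neg Φ → ◇ φ ∈ pos Ψ
    ◇neg : ∀ φ → ◇ φ ∈ neg Φ → ◇ φ ∈ neg Ψ

record IsType (Σ' : Pred Fm 0ℓ) (Φ : Pair) : Set where
  field
    neg⊆Σ    : neg Φ ⊆ Σ'
    pos⊆Σ    : pos Φ ⊆ Σ'
    disjoint : ∀ φ → ¬ (φ ∈ neg Φ × φ ∈ pos Φ)
    cover    : ∀ φ → φ ∈ Σ' → φ ∈ neg Φ ⊎ φ ∈ pos Φ
    ⊥∉pos    : ⊥' ∉ pos Φ
    ∧pos⇒    : ∀ φ ψ → (φ ∧ ψ) ∈ Σ' → (φ ∧ ψ) ∈ pos Φ → φ ∈ pos Φ × ψ ∈ pos Φ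
    ∧pos⇐    : ∀ φ ψ → (φ ∧ ψ) ∈ Σ' → φ ∈ pos Φ × ψ ∈ pos Φ → (φ ∧ ψ) ∈ pos Φ
    ∨pos⇒    : ∀ φ ψ → (φ ∨ ψ) ∈ Σ' → (φ ∨ ψ) ∈ pos Φ → φ ∈ pos Φ ⊎ ψ ∈ pos Φ
    ∨pos⇐    : ∀ φ ψ → (φ ∨ ψ) ∈ Σ' → φ ∈ pos Φ ⊎ ψ ∈ pos Φ → (φ ∨ ψ) ∈ pos Φ
    ⇒pos     : ∀ φ ψ → (φ ⇒ ψ) ∈ pos Φ → φ ∈ neg Φ ⊎ ψ ∈ pos Φ
    ◇neg     : ∀ φ → ◇ φ ∈ neg Φ → φ ∈ neg Φ

-- Labelled frames, weak quasimodels, determinism.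
-- The carrier W comes with an equality _≈_ (there are no quotients in
-- Agda); "partial order" is IsPartialOrder _≈_ _≼_.

module _ {a e r s : Level} {W : Set a} where

  record IsLabelledFrame (Σ' : Pred Fm 0ℓ) (_≈_ : Rel W e) (_≼_ : Rel W r)
                         (ℓ : W → Pair) : Set (a ⊔ e ⊔ r ⊔ suc 0ℓ) where
    field
      partialOrder : IsPartialOrder _≈_ _≼_
      labelType    : ∀ w → IsType Σ' (ℓ w)
      monotone     : ∀ {w v} → w ≼ v → pos (ℓ w) ⊆ pos (ℓ v)
      ⇒witness     : ∀ w φ ψ → (φ ⇒ ψ) ∈ neg (ℓ w) →
                     ∃[ v ] (w ≼ v × φ ∈ pos (ℓ v) × ψ ∈ neg (ℓ v))

  ForwardConfluent : Rel W r → Rel W s → Set (a ⊔ r ⊔ s)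
  ForwardConfluent _≼_ S =
    ∀ {w w' v} → w ≼ w' → S w v → ∃[ v' ] (S w' v' × v ≼ v')

  Sensible : Rel W s → (W → Pair) → Set (a ⊔ s)
  Sensible S ℓ = ∀ {w v} → S w v → ST (ℓ w) (ℓ v)

  record IsWeakQuasimodel (Σ' : Pred Fm 0ℓ) (_≈_ : Rel W e) (_≼_ : Rel W r)
                          (S : Rel W s) (ℓ : W → Pair)
                          : Set (a ⊔ e ⊔ r ⊔ s ⊔ suc 0ℓ) where
    field
      labelledFrame    : IsLabelledFrame Σ' _≈_ _≼_ ℓ
      forwardConfluent : ForwardConfluent _≼_ S
      sensible         : Sensible S ℓ

  record IsFunctional (_≈_ : Rel W e) (S : Rel W s) : Set (a ⊔ e ⊔ s) where
    field
      total  : ∀ w → ∃[ v ] S w v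
      unique : ∀ {w v v'} → S w v → S w v' → v ≈ v'

  record IsDeterministicWeakQuasimodel (Σ' : Pred Fm 0ℓ) (_≈_ : Rel W e)
           (_≼_ : Rel W r) (S : Rel W s) (ℓ : W → Pair)
           : Set (a ⊔ e ⊔ r ⊔ s ⊔ suc 0ℓ) where
    field
      weakQuasimodel : IsWeakQuasimodel Σ' _≈_ _≼_ S ℓ
      deterministic  : IsFunctional _≈_ S

record PrimeType : Set₁ where
  field
    pair       : Pair
    cover      : ∀ φ → φ ∈ neg pair ⊎ φ ∈ pos pair
    consistent : ¬ (pos pair ⊢ neg pair)
open PrimeType public

_≈c_ : Rel PrimeType 0ℓ
Φ ≈c Ψ = (pos (pair Φ) ⊆ pos (pair Ψ) × pos (pair Ψ) ⊆ pos (pair Φ))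
       × (neg (pair Φ) ⊆ neg (pair Ψ) × neg (pair Ψ) ⊆ neg (pair Φ))

_≼c_ : Rel PrimeType 0ℓ
Φ ≼c Ψ = pos (pair Φ) ⊆ pos (pair Ψ)

Sc : Rel PrimeType 0ℓ
Sc Φ Ψ = ST (pair Φ) (pair Ψ)

ℓc : PrimeType → Pair
ℓc = pair

-- Prime types are consistent, deductively closed and prime, so they are
-- L◇-types.  A prime type Φ has exactly one S_T-successor, namely
-- ({χ | ○χ ∈ Φ⁻}, {χ | ○χ ∈ Φ⁺}): it is consistent because ○ commutes with
-- ∧, ∨, ⇒ and ⊥, and it satisfies the ◇-clauses because the induction rule
-- yields the unfolding ◇φ → φ ∨ ○◇φ.  Forward confluence follows because
-- the positive part of this successor grows with Φ⁺.  A refuted implication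
-- φ ⇒ ψ is witnessed by a Lindenbaum extension of Φ⁺ ∪ {φ} avoiding ψ; as
-- Φ itself decides every formula, it can steer that construction, which
-- therefore needs no classical reasoning.
module Submission where

open import Defs
open import Level using (0ℓ)
open import Function using (id; _∘_)
open import Relation.Unary using (U; _∈_; _⊆_)
open import Relation.Binary.Structures using (IsEquivalence; IsPartialOrder)
open import Relation.Binary.PropositionalEquality using (refl)
open import Data.Nat using (ℕ; zero; suc; _⊔_; _≤′_)
open import Data.Nat.Base using (≤′-reflexive; ≤′-step)
open import Data.Nat.Properties using (≤⇒≤′; m≤m⊔n; m≤n⊔m)
open import Data.List using (List; []; _∷_; _++_; concatMap)
open import Data.List.Relation.Unary.All as All using (All; []; _∷_)
open import Data.List.Relation.Unary.Any using (here; there)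
open import Data.List.Membership.Propositional using () renaming (_∈_ to _∈ˡ_)
open import Data.List.Membership.Propositional.Properties
  using (∈-++⁺ˡ; ∈-++⁺ʳ; ∈-map⁺; ∈-concat⁺′)
open import Data.Product using (∃-syntax; _×_; _,_; proj₁; proj₂)
open import Data.Sum using (_⊎_; inj₁; inj₂; [_,_])
open import Data.Empty using (⊥; ⊥-elim)
open import Data.Unit using (tt)

⇒-refl : ∀ {φ} → ITL (φ ⇒ φ)
⇒-refl {φ} = mp (mp (ax-S {φ} {φ ⇒ φ} {φ}) ax-K) (ax-K {φ} {φ})

infixl 4 _▸_
data Ctx : Set where
  ε   : Ctx
  _▸_ : Ctx → Fm → Ctx

infixr 3 _⇛_
_⇛_ : Ctx → Fm → Fm
ε ⇛ φ       = φ
(Γ ▸ γ) ⇛ φ = Γ ⇛ γ ⇒ φ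

data _∋_ : Ctx → Fm → Set where
  top : ∀ {Γ φ} → (Γ ▸ φ) ∋ φ
  pop : ∀ {Γ φ ψ} → Γ ∋ φ → (Γ ▸ ψ) ∋ φ

data ND (Γ : Ctx) : Fm → Set where
  hyp : ∀ {φ} → Γ ∋ φ → ND Γ φ
  thm : ∀ {φ} → ITL φ → ND Γ φ
  app : ∀ {φ ψ} → ND Γ (φ ⇒ ψ) → ND Γ φ → ND Γ ψ
  lam : ∀ {φ ψ} → ND (Γ ▸ φ) ψ → ND Γ (φ ⇒ ψ)

⇛-const : ∀ Γ {φ} → ITL φ → ITL (Γ ⇛ φ)
⇛-const ε       p = p
⇛-const (Γ ▸ γ) p = ⇛-const Γ (mp ax-K p)

⇛-app : ∀ Γ {φ ψ} → ITL (Γ ⇛ φ ⇒ ψ) → ITL (Γ ⇛ φ) → ITL (Γ ⇛ ψ)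
⇛-app ε       f x = mp f x
⇛-app (Γ ▸ γ) f x = ⇛-app Γ (⇛-app Γ (⇛-const Γ ax-S) f) x

⇛-hyp : ∀ Γ {φ} → Γ ∋ φ → ITL (Γ ⇛ φ)
⇛-hyp (Γ ▸ φ) top     = ⇛-const Γ ⇒-refl
⇛-hyp (Γ ▸ ψ) (pop i) = ⇛-app Γ (⇛-const Γ ax-K) (⇛-hyp Γ i)

deduction : ∀ {Γ φ} → ND Γ φ → ITL (Γ ⇛ φ)
deduction {Γ} (hyp i)   = ⇛-hyp Γ i
deduction {Γ} (thm p)   = ⇛-const Γ p
deduction {Γ} (app f x) = ⇛-app Γ (deduction f) (deduction x)
deduction     (lam d)   = deduction d

ND⇒ITL : ∀ {φ} → ND ε φ → ITL φ
ND⇒ITL = deduction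

module _ {Γ : Ctx} where

  #0 : ∀ {φ} → ND (Γ ▸ φ) φ
  #0 = hyp top

  #1 : ∀ {φ ψ} → ND (Γ ▸ φ ▸ ψ) φ
  #1 = hyp (pop top)

  #2 : ∀ {φ ψ χ} → ND (Γ ▸ φ ▸ ψ ▸ χ) φ
  #2 = hyp (pop (pop top))

  #3 : ∀ {φ ψ χ θ} → ND (Γ ▸ φ ▸ ψ ▸ χ ▸ θ) φ
  #3 = hyp (pop (pop (pop top)))

  ∧i : ∀ {φ ψ} → ND Γ φ → ND Γ ψ → ND Γ (φ ∧ ψ)
  ∧i d e = app (app (thm ax-∧I) d) e

  ∧e₁ : ∀ {φ ψ} → ND Γ (φ ∧ ψ) → ND Γ φ
  ∧e₁ = app (thm ax-∧E₁)

  ∧e₂ : ∀ {φ ψ} → ND Γ (φ ∧ ψ) → ND Γ ψ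
  ∧e₂ = app (thm ax-∧E₂)

  ∨i₁ : ∀ {φ ψ} → ND Γ φ → ND Γ (φ ∨ ψ)
  ∨i₁ = app (thm ax-∨I₁)

  ∨i₂ : ∀ {φ ψ} → ND Γ ψ → ND Γ (φ ∨ ψ)
  ∨i₂ = app (thm ax-∨I₂)

  ∨e : ∀ {φ ψ χ} → ND Γ (φ ∨ ψ) → ND (Γ ▸ φ) χ → ND (Γ ▸ ψ) χ → ND Γ χ
  ∨e d f g = app (app (app (thm ax-∨E) (lam f)) (lam g)) d

  ⊥e : ∀ {φ} → ND Γ ⊥' → ND Γ φ
  ⊥e = app (thm ax-⊥E)

⇒-trans : ∀ {φ ψ χ} → ITL (φ ⇒ ψ) → ITL (ψ ⇒ χ) → ITL (φ ⇒ χ)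
⇒-trans f g = ND⇒ITL (lam (app (thm g) (app (thm f) #0)))

◇-intro : ∀ {φ} → ITL (φ ⇒ ◇ φ)
◇-intro = ND⇒ITL (lam (app (thm ax-◇fix) (∨i₁ #0)))

○◇⇒◇ : ∀ {φ} → ITL (○ (◇ φ) ⇒ ◇ φ)
○◇⇒◇ = ND⇒ITL (lam (app (thm ax-◇fix) (∨i₂ #0)))

○-mono : ∀ {φ ψ} → ITL (φ ⇒ ψ) → ITL (○ φ ⇒ ○ ψ)
○-mono f = mp ax-○⇒ (nec f)

-- φ ∨ ○◇φ is a ○-prefixed point, so the induction rule bounds ◇φ by it.
◇-unfold : ∀ {φ} → ITL (◇ φ ⇒ φ ∨ ○ (◇ φ))
◇-unfold {φ} = ⇒-trans (◇mono (ND⇒ITL (lam (∨i₁ #0)))) (◇ind prefixed)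
  where
  prefixed : ITL (○ (φ ∨ ○ (◇ φ)) ⇒ φ ∨ ○ (◇ φ))
  prefixed = ND⇒ITL (lam (∨i₂ (∨e (app (thm ax-○∨) #0)
               (app (thm (○-mono ◇-intro)) #0)
               (app (thm (○-mono ○◇⇒◇)) #0))))

module PrimeTypeProperties (Φ : PrimeType) where

  Φ⁺ Φ⁻ : Fm → Set
  Φ⁺ = pos (pair Φ)
  Φ⁻ = neg (pair Φ)

  disjoint : ∀ {χ} → χ ∈ Φ⁻ → χ ∈ Φ⁺ → ⊥
  disjoint {χ} n p =
    consistent Φ (χ ∷ [] , χ ∷ [] , p ∷ [] , n ∷ [] , ND⇒ITL (lam (∨i₁ (∧e₁ #0))))

  ⊥∉⁺ : ⊥' ∈ Φ⁺ → ⊥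
  ⊥∉⁺ p = consistent Φ (⊥' ∷ [] , [] , p ∷ [] , [] , ND⇒ITL (lam (∧e₁ #0)))

  theorem∈⁺ : ∀ {χ} → ITL χ → χ ∈ Φ⁺
  theorem∈⁺ {χ} t with cover Φ χ
  ... | inj₂ p = p
  ... | inj₁ n = ⊥-elim (consistent Φ ([] , χ ∷ [] , [] , n ∷ [] , ND⇒ITL (lam (∨i₁ (thm t)))))

  mp∈⁺ : ∀ {φ ψ} → (φ ⇒ ψ) ∈ Φ⁺ → φ ∈ Φ⁺ → ψ ∈ Φ⁺
  mp∈⁺ {φ} {ψ} f x with cover Φ ψ
  ... | inj₂ p = p
  ... | inj₁ n = ⊥-elim (consistent Φ
    ( (φ ⇒ ψ) ∷ φ ∷ [] , ψ ∷ [] , f ∷ x ∷ [] , n ∷ []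
    , ND⇒ITL (lam (∨i₁ (app (∧e₁ #0) (∧e₁ (∧e₂ #0)))))))

  ⁺-closed : ∀ {φ ψ} → ITL (φ ⇒ ψ) → φ ∈ Φ⁺ → ψ ∈ Φ⁺
  ⁺-closed t = mp∈⁺ (theorem∈⁺ t)

  ⁺-closed₂ : ∀ {φ ψ χ} → ITL (φ ⇒ ψ ⇒ χ) → φ ∈ Φ⁺ → ψ ∈ Φ⁺ → χ ∈ Φ⁺
  ⁺-closed₂ t p = mp∈⁺ (⁺-closed t p)

  ⁻-closed : ∀ {φ ψ} → ITL (φ ⇒ ψ) → ψ ∈ Φ⁻ → φ ∈ Φ⁻
  ⁻-closed {φ} t n with cover Φ φ
  ... | inj₁ m = m
  ... | inj₂ p = ⊥-elim (disjoint n (⁺-closed t p))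

  ∨∈⁺ : ∀ {φ ψ} → (φ ∨ ψ) ∈ Φ⁺ → φ ∈ Φ⁺ ⊎ ψ ∈ Φ⁺
  ∨∈⁺ {φ} {ψ} p with cover Φ φ | cover Φ ψ
  ... | inj₂ x | _      = inj₁ x
  ... | inj₁ _ | inj₂ y = inj₂ y
  ... | inj₁ x | inj₁ y = ⊥-elim (consistent Φ
    ( (φ ∨ ψ) ∷ [] , φ ∷ ψ ∷ [] , p ∷ [] , x ∷ y ∷ []
    , ND⇒ITL (lam (∨e (∧e₁ #0) (∨i₁ #0) (∨i₂ (∨i₁ #0))))))

  ⁻-closed₂ : ∀ {φ ψ χ} → ITL (φ ⇒ ψ ⇒ χ) → ψ ∈ Φ⁺ → χ ∈ Φ⁻ → φ ∈ Φ⁻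
  ⁻-closed₂ {φ} t q n with cover Φ φ
  ... | inj₁ m = m
  ... | inj₂ p = ⊥-elim (disjoint n (⁺-closed₂ t p q))

  ⇒∈⁺ : ∀ φ ψ → (φ ⇒ ψ) ∈ Φ⁺ → φ ∈ Φ⁻ ⊎ ψ ∈ Φ⁺
  ⇒∈⁺ φ ψ f with cover Φ φ
  ... | inj₁ n = inj₁ n
  ... | inj₂ p = inj₂ (mp∈⁺ f p)

  isType : IsType U (pair Φ)
  isType = record
    { neg⊆Σ    = λ _ → tt
    ; pos⊆Σ    = λ _ → tt
    ; disjoint = λ _ (n , p) → disjoint n p
    ; cover    = λ χ _ → cover Φ χ
    ; ⊥∉pos    = ⊥∉⁺
    ; ∧pos⇒    = λ _ _ _ p → ⁺-closed ax-∧E₁ p , ⁺-closed ax-∧E₂ p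
    ; ∧pos⇐    = λ _ _ _ (p , q) → ⁺-closed₂ ax-∧I p q
    ; ∨pos⇒    = λ _ _ _ → ∨∈⁺
    ; ∨pos⇐    = λ _ _ _ → [ ⁺-closed ax-∨I₁ , ⁺-closed ax-∨I₂ ]
    ; ⇒pos     = ⇒∈⁺
    ; ◇neg     = λ _ → ⁻-closed ◇-intro
    }

≼c⇒neg⊇ : ∀ {Φ Ψ} → Φ ≼c Ψ → neg (pair Ψ) ⊆ neg (pair Φ)
≼c⇒neg⊇ {Φ} {Ψ} Φ⁺⊆Ψ⁺ {χ} n with cover Φ χ
... | inj₁ m = m
... | inj₂ p = ⊥-elim (PrimeTypeProperties.disjoint Ψ n (Φ⁺⊆Ψ⁺ p))

≈c-isEquivalence : IsEquivalence _≈c_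
≈c-isEquivalence = record
  { refl  = (id , id) , (id , id)
  ; sym   = λ ((a , b) , (c , d)) → (b , a) , (d , c)
  ; trans = λ ((a , b) , (c , d)) ((a′ , b′) , (c′ , d′)) →
              (a′ ∘ a , b ∘ b′) , (c′ ∘ c , d ∘ d′)
  }

≼c-isPartialOrder : IsPartialOrder _≈c_ _≼c_
≼c-isPartialOrder = record
  { isPreorder = record
    { isEquivalence = ≈c-isEquivalence
    ; reflexive     = proj₁ ∘ proj₁
    ; trans         = λ f g → g ∘ f
    }
  ; antisym = λ {Φ} {Ψ} Φ≼Ψ Ψ≼Φ → (Φ≼Ψ , Ψ≼Φ) , (≼c⇒neg⊇ {Ψ} {Φ} Ψ≼Φ , ≼c⇒neg⊇ {Φ} {Ψ} Φ≼Ψ)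
  }

module _ (Φ : PrimeType) where
  open PrimeTypeProperties Φ

  ○⋀∈⁺ : ∀ {Γ} → All (λ χ → ○ χ ∈ Φ⁺) Γ → ○ (⋀ Γ) ∈ Φ⁺
  ○⋀∈⁺ []       = theorem∈⁺ (nec ⇒-refl)
  ○⋀∈⁺ (p ∷ ps) = ⁺-closed₂ (ND⇒ITL (lam (lam (app (thm ax-○∧) (∧i #1 #0))))) p (○⋀∈⁺ ps)

  ○⋁∉⁺ : ∀ {Δ} → All (λ χ → ○ χ ∈ Φ⁻) Δ → ○ (⋁ Δ) ∈ Φ⁺ → ⊥
  ○⋁∉⁺ []       p = ⊥∉⁺ (⁺-closed ax-○⊥ p)
  ○⋁∉⁺ (n ∷ ns) p = [ disjoint n , ○⋁∉⁺ ns ] (∨∈⁺ (⁺-closed ax-○∨ p))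

  next : PrimeType
  next = record
    { pair       = ⟨ (λ χ → ○ χ ∈ Φ⁻) , (λ χ → ○ χ ∈ Φ⁺) ⟩
    ; cover      = λ χ → cover Φ (○ χ)
    ; consistent = λ (Γ , Δ , ps , ns , d) →
        ○⋁∉⁺ ns (⁺-closed (○-mono d) (○⋀∈⁺ ps))
    }

  Sc-next : Sc Φ next
  Sc-next = record
    { ○pos = λ _ → id
    ; ○neg = λ _ → id
    ; ◇pos = λ _ p n → [ ⊥-elim ∘ disjoint n , id ] (∨∈⁺ (⁺-closed ◇-unfold p))
    ; ◇neg = λ _ → ⁻-closed ○◇⇒◇
    }

module _ {Φ Ψ : PrimeType} (S : Sc Φ Ψ) where

  Sc⇒○pos : ∀ {χ} → χ ∈ pos (pair Ψ) → ○ χ ∈ pos (pair Φ)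
  Sc⇒○pos {χ} p with cover Φ (○ χ)
  ... | inj₂ q = q
  ... | inj₁ n = ⊥-elim (PrimeTypeProperties.disjoint Ψ (ST.○neg S χ n) p)

  Sc⇒○neg : ∀ {χ} → χ ∈ neg (pair Ψ) → ○ χ ∈ neg (pair Φ)
  Sc⇒○neg {χ} n with cover Φ (○ χ)
  ... | inj₁ m = m
  ... | inj₂ q = ⊥-elim (PrimeTypeProperties.disjoint Ψ n (ST.○pos S χ q))

Sc-unique : ∀ {Φ Ψ Ψ′} → Sc Φ Ψ → Sc Φ Ψ′ → Ψ ≈c Ψ′
Sc-unique {Φ} {Ψ} {Ψ′} S S′ =
    ( (λ p → ST.○pos S′ _ (Sc⇒○pos {Φ} {Ψ} S p))
    , (λ p → ST.○pos S _ (Sc⇒○pos {Φ} {Ψ′} S′ p)) )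
  , ( (λ n → ST.○neg S′ _ (Sc⇒○neg {Φ} {Ψ} S n))
    , (λ n → ST.○neg S _ (Sc⇒○neg {Φ} {Ψ′} S′ n)) )

Sc-forwardConfluent : ForwardConfluent {e = 0ℓ} _≼c_ Sc
Sc-forwardConfluent {Φ} {Φ′} {Ψ} Φ⁺⊆Φ′⁺ S =
  next Φ′ , Sc-next Φ′ , λ p → Φ⁺⊆Φ′⁺ (Sc⇒○pos {Φ} {Ψ} S p)

module _ {A : Set} (Q : ℕ → A → Set) where

  Increasing : Set
  Increasing = ∀ k {x} → Q k x → Q (suc k) x

  increasing⇒monotone : Increasing → ∀ {k m x} → k ≤′ m → Q k x → Q m x
  increasing⇒monotone inc (≤′-reflexive refl) q = q
  increasing⇒monotone inc (≤′-step {m} k≤m)   q = inc m (increasing⇒monotone inc k≤m q)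

  eventually-all : Increasing → ∀ {xs} → All (λ x → ∃[ k ] Q k x) xs → ∃[ n ] All (Q n) xs
  eventually-all inc []             = 0 , []
  eventually-all inc ((k , q) ∷ qs) with eventually-all inc qs
  ... | n , qs′ = k ⊔ n
                , increasing⇒monotone inc (≤⇒≤′ (m≤m⊔n k n)) q
                ∷ All.map (increasing⇒monotone inc (≤⇒≤′ (m≤n⊔m k n))) qs′

binaries : Fm → Fm → List Fm
binaries φ ψ = (φ ∧ ψ) ∷ (φ ∨ ψ) ∷ (φ ⇒ ψ) ∷ []

successors : List Fm → Fm → List Fm
successors L φ = ○ φ ∷ ◇ φ ∷ concatMap (binaries φ) L

stage : ℕ → List Fm
stage zero    = []
stage (suc k) = ⊥' ∷ var k ∷ stage k ++ concatMap (successors (stage k)) (stage k)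

stage-increasing : Increasing (λ k χ → χ ∈ˡ stage k)
stage-increasing _ p = there (there (∈-++⁺ˡ p))

∈-stage-successors : ∀ {k φ χ} → φ ∈ˡ stage k → χ ∈ˡ successors (stage k) φ →
                     χ ∈ˡ stage (suc k)
∈-stage-successors {k} φ∈ χ∈ =
  there (there (∈-++⁺ʳ (stage k) (∈-concat⁺′ χ∈ (∈-map⁺ (successors (stage k)) φ∈))))

∈-stage-binaries : ∀ {φ ψ χ} → ∃[ k ] φ ∈ˡ stage k → ∃[ k ] ψ ∈ˡ stage k →
                   χ ∈ˡ binaries φ ψ → ∃[ k ] χ ∈ˡ stage k
∈-stage-binaries {φ} φ∈ ψ∈ χ∈
  with eventually-all (λ k χ → χ ∈ˡ stage k) stage-increasing (φ∈ ∷ ψ∈ ∷ [])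
... | k , φ∈′ ∷ ψ∈′ ∷ [] =
  suc k , ∈-stage-successors φ∈′ (there (there (∈-concat⁺′ χ∈ (∈-map⁺ (binaries φ) ψ∈′))))

stage-exhaustive : ∀ χ → ∃[ k ] χ ∈ˡ stage k
stage-exhaustive ⊥'      = 1 , here refl
stage-exhaustive (var n) = suc n , there (here refl)
stage-exhaustive (φ ∧ ψ) =
  ∈-stage-binaries (stage-exhaustive φ) (stage-exhaustive ψ) (here refl)
stage-exhaustive (φ ∨ ψ) =
  ∈-stage-binaries (stage-exhaustive φ) (stage-exhaustive ψ) (there (here refl))
stage-exhaustive (φ ⇒ ψ) =
  ∈-stage-binaries (stage-exhaustive φ) (stage-exhaustive ψ) (there (there (here refl)))
stage-exhaustive (○ φ) =
  let k , p = stage-exhaustive φ in suc k , ∈-stage-successors p (here refl)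
stage-exhaustive (◇ φ) =
  let k , p = stage-exhaustive φ in suc k , ∈-stage-successors p (there (here refl))

module Lindenbaum (Φ : PrimeType) {φ ψ : Fm} (φ⇒ψ∈Φ⁻ : (φ ⇒ ψ) ∈ neg (pair Φ)) where
  open PrimeTypeProperties Φ

  -- Finitely many accepted (rejected) formulas are kept as one conjunction
  -- (disjunction); Φ⁻ plays the role of "not derivable".
  record Stage : Set where
    field
      accepted rejected : Fm
      refuted           : (φ ∧ accepted ⇒ ψ ∨ rejected) ∈ Φ⁻
  open Stage

  Accepts Rejects Decides : Stage → Fm → Set
  Accepts s χ = (φ ∧ accepted s ⇒ χ) ∈ Φ⁺
  Rejects s χ = (χ ⇒ ψ ∨ rejected s) ∈ Φ⁺
  Decides s χ = Accepts s χ ⊎ Rejects s χ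

  record _⊑_ (s t : Stage) : Set where
    constructor extends
    field
      accepts : ∀ {χ} → Accepts s χ → Accepts t χ
      rejects : ∀ {χ} → Rejects s χ → Rejects t χ
  open _⊑_

  ⊑-refl : ∀ {s} → s ⊑ s
  ⊑-refl = extends id id

  ⊑-trans : ∀ {s t u} → s ⊑ t → t ⊑ u → s ⊑ u
  ⊑-trans s⊑t t⊑u = extends (accepts t⊑u ∘ accepts s⊑t) (rejects t⊑u ∘ rejects s⊑t)

  ⊑-by : ∀ {s t} → ITL (accepted t ⇒ accepted s) → ITL (rejected s ⇒ rejected t) → s ⊑ t
  ⊑-by a r = extends
    (⁺-closed (ND⇒ITL (lam (lam (app #1 (∧i (∧e₁ #0) (app (thm a) (∧e₂ #0))))))))
    (⁺-closed (ND⇒ITL (lam (lam (∨e (app #1 #0) (∨i₁ #0) (∨i₂ (app (thm r) #0)))))))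

  ⋀-accepted : ∀ {s Γ} → All (Accepts s) Γ → Accepts s (⋀ Γ)
  ⋀-accepted []       = theorem∈⁺ (ND⇒ITL (lam (lam #0)))
  ⋀-accepted {s} (a ∷ as) =
    ⁺-closed₂ (ND⇒ITL (lam (lam (lam (∧i (app #2 #0) (app #1 #0)))))) a (⋀-accepted {s} as)

  ⋁-rejected : ∀ {s Δ} → All (Rejects s) Δ → Rejects s (⋁ Δ)
  ⋁-rejected []       = theorem∈⁺ (ND⇒ITL (lam (⊥e #0)))
  ⋁-rejected {s} (r ∷ rs) =
    ⁺-closed₂ (ND⇒ITL (lam (lam (lam (∨e #0 (app #3 #0) (app #2 #0)))))) r (⋁-rejected {s} rs)

  stage-consistent : ∀ s {Γ Δ} → All (Accepts s) Γ → All (Rejects s) Δ →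
                     ITL (⋀ Γ ⇒ ⋁ Δ) → ⊥
  stage-consistent s {Γ} {Δ} as rs d =
    disjoint (refuted s) (⁺-closed₂ compose (⋀-accepted {s} as) (⋁-rejected {s} rs))
    where
    compose : ITL ((φ ∧ accepted s ⇒ ⋀ Γ) ⇒ (⋁ Δ ⇒ ψ ∨ rejected s) ⇒
                   φ ∧ accepted s ⇒ ψ ∨ rejected s)
    compose = ND⇒ITL (lam (lam (lam (app #1 (app (thm d) (app #2 #0))))))

  -- Φ decides whether χ may be accepted, in place of the undecidable test
  -- "accepted ∧ χ ⊬ rejected" of the classical construction.
  step : ∀ s χ → ∃[ t ] (s ⊑ t × Decides t χ)
  step s χ with cover Φ (φ ∧ (accepted s ∧ χ) ⇒ ψ ∨ rejected s)
  ... | inj₁ n =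
    record { accepted = accepted s ∧ χ ; rejected = rejected s ; refuted = n }
    , ⊑-by ax-∧E₁ ⇒-refl , inj₁ (theorem∈⁺ (ND⇒ITL (lam (∧e₂ (∧e₂ #0)))))
  ... | inj₂ p =
    record { accepted = accepted s ; rejected = rejected s ∨ χ
           ; refuted  = ⁻-closed₂ cut p (refuted s) }
    , ⊑-by ⇒-refl ax-∨I₁ , inj₂ (theorem∈⁺ (ND⇒ITL (lam (∨i₂ (∨i₂ #0)))))
    where
    cut : ITL ((φ ∧ accepted s ⇒ ψ ∨ (rejected s ∨ χ)) ⇒
               (φ ∧ (accepted s ∧ χ) ⇒ ψ ∨ rejected s) ⇒
               φ ∧ accepted s ⇒ ψ ∨ rejected s)
    cut = ND⇒ITL (lam (lam (lam (∨e (app #2 #0) (∨i₁ #0)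
            (∨e #0 (∨i₂ #0) (app #3 (∧i (∧e₁ #2) (∧i (∧e₂ #2) #0))))))))

  steps : ∀ s L → ∃[ t ] (s ⊑ t × (∀ {χ} → χ ∈ˡ L → Decides t χ))
  steps s []      = s , ⊑-refl , λ ()
  steps s (χ ∷ L) with step s χ
  ... | t , s⊑t , dχ with steps t L
  ... | u , t⊑u , dL = u , ⊑-trans s⊑t t⊑u , decides
    where
    decides : ∀ {θ} → θ ∈ˡ χ ∷ L → Decides u θ
    decides (here refl) = [ inj₁ ∘ accepts t⊑u , inj₂ ∘ rejects t⊑u ] dχ
    decides (there θ∈L) = dL θ∈L

  chain : ℕ → Stage
  chain zero    = record
    { accepted = ⊤'
    ; rejected = ⊥'
    ; refuted  = ⁻-closed (ND⇒ITL (lam (lam (∨e (app #1 (∧i #0 (lam #0))) #0 (⊥e #0)))))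
                          φ⇒ψ∈Φ⁻
    }
  chain (suc k) = proj₁ (steps (chain k) (stage k))

  chain-⊑-suc : ∀ k → chain k ⊑ chain (suc k)
  chain-⊑-suc k = proj₁ (proj₂ (steps (chain k) (stage k)))

  chain-decides : ∀ {k χ} → χ ∈ˡ stage k → Decides (chain (suc k)) χ
  chain-decides {k} = proj₂ (proj₂ (steps (chain k) (stage k)))

  Accepted Rejected : ℕ → Fm → Set
  Accepted k = Accepts (chain k)
  Rejected k = Rejects (chain k)

  accepted-increasing : Increasing Accepted
  accepted-increasing k = accepts (chain-⊑-suc k)

  rejected-increasing : Increasing Rejected
  rejected-increasing k = rejects (chain-⊑-suc k)

  eventually-decided : ∀ χ → (∃[ k ] Rejected k χ) ⊎ (∃[ k ] Accepted k χ)
  eventually-decided χ with stage-exhaustive χ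
  ... | k , χ∈ = [ (λ a → inj₂ (suc k , a)) , (λ r → inj₁ (suc k , r)) ] (chain-decides χ∈)

  eventually-consistent : ∀ {Γ Δ} → All (λ χ → ∃[ k ] Accepted k χ) Γ →
                          All (λ χ → ∃[ k ] Rejected k χ) Δ → ITL (⋀ Γ ⇒ ⋁ Δ) → ⊥
  eventually-consistent as rs
    with eventually-all Accepted accepted-increasing as
       | eventually-all Rejected rejected-increasing rs
  ... | k , as′ | m , rs′ = stage-consistent (chain (k ⊔ m))
    (All.map (increasing⇒monotone Accepted accepted-increasing (≤⇒≤′ (m≤m⊔n k m))) as′)
    (All.map (increasing⇒monotone Rejected rejected-increasing (≤⇒≤′ (m≤n⊔m k m))) rs′)

  extension : PrimeType
  extension = record
    { pair       = ⟨ (λ χ → ∃[ k ] Rejected k χ) , (λ χ → ∃[ k ] Accepted k χ) ⟩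
    ; cover      = eventually-decided
    ; consistent = λ (_ , _ , as , rs , d) → eventually-consistent as rs d
    }

  extension-witnesses : Φ ≼c extension × φ ∈ pos (pair extension) × ψ ∈ neg (pair extension)
  extension-witnesses =
    (λ p → 0 , ⁺-closed ax-K p) , (0 , theorem∈⁺ ax-∧E₁) , (0 , theorem∈⁺ ax-∨I₁)

⇒-witness : ∀ Φ φ ψ → (φ ⇒ ψ) ∈ neg (pair Φ) →
            ∃[ Ψ ] (Φ ≼c Ψ × φ ∈ pos (pair Ψ) × ψ ∈ neg (pair Ψ))
⇒-witness Φ φ ψ n = Lindenbaum.extension Φ n , Lindenbaum.extension-witnesses Φ n

proposition4p4 : IsDeterministicWeakQuasimodel U _≈c_ _≼c_ Sc ℓc
proposition4p4 = record
  { weakQuasimodel = record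
    { labelledFrame    = record
      { partialOrder = ≼c-isPartialOrder
      ; labelType    = PrimeTypeProperties.isType
      ; monotone     = id
      ; ⇒witness     = ⇒-witness
      }
    ; forwardConfluent = λ {Φ} {Φ′} {Ψ} → Sc-forwardConfluent {Φ} {Φ′} {Ψ}
    ; sensible         = id
    }
  ; deterministic = record
    { total  = λ Φ → next Φ , Sc-next Φ
    ; unique = λ {Φ} {Ψ} {Ψ′} → Sc-unique {Φ} {Ψ} {Ψ′}
    }
  }
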